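{- Let $G$ be an st-graph with width $w_G$, let $C_P$ be a (transitive) congruence partition of $G$, and let $w_N$ be the dimensional neck of $G(C_P)$. Then $w_N\le w_G$.
   Context: An st-graph is a directed acyclic graph with exactly one source and one sink. The width of a DAG is the maximum size of a set of pairwise incomparable vertices (neither reaches the other via a directed path). Let $G^*$ be the transitive closure of $G=(V,E)$. A transitive module is a nonempty $M\subseteq V$ whose vertices all have the same predecessors and the same successors in $V\setminus M$ in $G^*$. A congruence partition $C_P=\{M_1,\dots,M_h\}$ is a partition of $V$ into transitive modules. The quotient graph $G_0$ is obtained from $G$ by merging the vertices of each $M_i$ into one vertex. For $1\le i\le h$, the module-induced graph $G_i$ is the subgraph induced by $M_i$, augmented when necessary with a virtual source (edges to all of $M_i$) and/or virtual sink (edges from all of $M_i$) so that it is an st-graph. $G(C_P)=\{G_0,\dots,G_h\}$ and its dimensional neck $w_N$ is the maximum width of a graph in $G(C_P)$. -}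

module Defs where

open import Data.Nat using (ℕ; _≤_)
open import Data.Fin using (Fin)
open import Data.Bool using (Bool; true; false)
open import Data.Unit using (⊤)
open import Data.Empty using (⊥)
open import Data.Sum using (_⊎_; inj₁; inj₂)
open import Data.Product using (Σ; ∃; _×_; _,_; proj₁)
open import Data.List using (List; length)
open import Data.List.Relation.Unary.AllPairs using (AllPairs)
open import Relation.Nullary using (¬_)
open import Relation.Binary.PropositionalEquality using (_≡_; _≢_)
open import Relation.Binary.Construct.Closure.Transitive using (TransClosure)

record Digraph : Set₁ where
  field
    V : Set
    E : V → V → Set
open Digraph public

Reach : (G : Digraph) → V G → V G → Set
Reach G = TransClosure (E G)

Acyclic : Digraph → Set
Acyclic G = ∀ v → ¬ Reach G v v

IsSource IsSink : (G : Digraph) → V G → Set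
IsSource G s = ∀ u → ¬ E G u s
IsSink   G t = ∀ u → ¬ E G t u

UniqueSource UniqueSink : Digraph → Set
UniqueSource G = Σ (V G) λ s → IsSource G s × (∀ v → IsSource G v → v ≡ s)
UniqueSink   G = Σ (V G) λ t → IsSink G t × (∀ v → IsSink G v → v ≡ t)

IsSTGraph : Digraph → Set
IsSTGraph G = Acyclic G × UniqueSource G × UniqueSink G

Incomparable : (G : Digraph) → V G → V G → Set
Incomparable G u v = u ≢ v × ¬ Reach G u v × ¬ Reach G v u

Antichain : (G : Digraph) → List (V G) → Set
Antichain G = AllPairs (Incomparable G)

HasWidth : Digraph → ℕ → Set
HasWidth G w = (Σ (List (V G)) λ xs → Antichain G xs × length xs ≡ w)
             × (∀ xs → Antichain G xs → length xs ≤ w)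

FinGraph : (n : ℕ) → (Fin n → Fin n → Set) → Digraph
FinGraph n E = record { V = Fin n ; E = E }

IsTransitiveModule : (G : Digraph) → (V G → Set) → Set
IsTransitiveModule G M =
  (Σ (V G) M) ×
  (∀ x y z → M x → M y → ¬ M z →
     ((Reach G z x → Reach G z y) × (Reach G z y → Reach G z x)) ×
     ((Reach G x z → Reach G y z) × (Reach G y z → Reach G x z)))

-- The partition {M_1,…,M_h} is represented by the class map f : V → Fin h,
-- M_i = f⁻¹(i).  Classes nonempty is part of IsTransitiveModule.
Class : (G : Digraph) {h : ℕ} → (V G → Fin h) → Fin h → V G → Set
Class G f i v = f v ≡ i

IsCongruencePartition : (G : Digraph) (h : ℕ) → (V G → Fin h) → Set
IsCongruencePartition G h f = ∀ i → IsTransitiveModule G (Class G f i)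

Quotient : (G : Digraph) (h : ℕ) → (V G → Fin h) → Digraph
Quotient G h f = record
  { V = Fin h
  ; E = λ i j → i ≢ j × Σ (V G) λ u → Σ (V G) λ v → f u ≡ i × f v ≡ j × E G u v }

Induced : (G : Digraph) {h : ℕ} → (V G → Fin h) → Fin h → Digraph
Induced G f i = record
  { V = Σ (V G) (Class G f i)
  ; E = λ u v → E G (proj₁ u) (proj₁ v) }

Opt : Bool → Set
Opt true  = ⊤
Opt false = ⊥

AugE : (H : Digraph) (bs bt : Bool) →
       (Opt bs ⊎ V H ⊎ Opt bt) → (Opt bs ⊎ V H ⊎ Opt bt) → Set
AugE H bs bt (inj₁ _)        (inj₂ (inj₁ _)) = ⊤
AugE H bs bt (inj₂ (inj₁ u)) (inj₂ (inj₁ v)) = E H u v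
AugE H bs bt (inj₂ (inj₁ _)) (inj₂ (inj₂ _)) = ⊤
AugE H bs bt _               _               = ⊥

Augment : Digraph → Bool → Bool → Digraph
Augment H bs bt = record { V = Opt bs ⊎ V H ⊎ Opt bt ; E = AugE H bs bt }

-- the virtual source (sink) is added exactly when necessary, i.e. exactly
-- when the induced graph does not have a unique source (sink).
Necessary : Set → Bool → Set
Necessary P b = (b ≡ true → ¬ P) × (b ≡ false → P)

IsModuleGraphChoice : (G : Digraph) {h : ℕ} → (V G → Fin h) → Fin h → Bool → Bool → Set
IsModuleGraphChoice G f i bs bt =
  Necessary (UniqueSource (Induced G f i)) bs × Necessary (UniqueSink (Induced G f i)) bt

ModuleGraph : (G : Digraph) {h : ℕ} → (V G → Fin h) → Fin h → Bool → Bool → Digraph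
ModuleGraph G f i bs bt = Augment (Induced G f i) bs bt

-- wN is the dimensional neck of G(C_P) = {G₀, G₁, …, G_h}:
-- the maximum width of a graph in the family.
HasNeck : (G : Digraph) (h : ℕ) → (V G → Fin h) → ℕ → Set
HasNeck G h f wN =
  (∀ w → HasWidth (Quotient G h f) w → w ≤ wN) ×
  (∀ i bs bt w → IsModuleGraphChoice G f i bs bt →
     HasWidth (ModuleGraph G f i bs bt) w → w ≤ wN) ×
  (HasWidth (Quotient G h f) wN ⊎
   Σ (Fin h) λ i → Σ Bool λ bs → Σ Bool λ bt →
     IsModuleGraphChoice G f i bs bt × HasWidth (ModuleGraph G f i bs bt) wN)

-- Each graph of G(C_P) admits a map into G that sends incomparable pairs to
-- incomparable pairs, so its antichains become antichains of G of the same
-- size.  For the quotient, send each class to a representative: a path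
-- between representatives of distinct classes projects to a path in the
-- quotient.  For a module graph, forget the virtual source and sink (they
-- are comparable to every vertex) and include the module into G: a path of G
-- between two module vertices never leaves the module, for if it passed
-- through an outside vertex z, the module property would send z back to the
-- start of the path, closing a cycle.
module Submission where

open import Defs
open import Axiom.UniquenessOfIdentityProofs using (module Decidable⇒UIP)
open import Data.Nat using (ℕ; _≤_)
open import Data.Fin using (Fin; _≟_)
open import Data.Bool using (Bool; true)
open import Data.Unit using (tt)
open import Data.Empty using (⊥-elim)
open import Data.Sum using (_⊎_; inj₁; inj₂)
open import Data.Product using (Σ; ∃; _×_; _,_; proj₁; proj₂)
open import Data.List using (map)
open import Data.List.Properties using (length-map)
import Data.List.Relation.Unary.AllPairs as AllPairs
open import Data.List.Relation.Unary.AllPairs.Properties using (map⁺)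
open import Function using (_∘_)
open import Relation.Nullary using (yes; no)
open import Relation.Binary.PropositionalEquality
  using (_≡_; _≢_; refl; sym; trans; cong; subst; subst₂)
open import Relation.Binary.Construct.Closure.Transitive using ([_]; _∷_; _++_)

PreservesIncomparability : (H G : Digraph) → (V H → V G) → Set
PreservesIncomparability H G φ =
  ∀ {a b} → Incomparable H a b → Incomparable G (φ a) (φ b)

width-≤ : ∀ {H G : Digraph} {φ : V H → V G} {v w : ℕ} →
  PreservesIncomparability H G φ → HasWidth H v → HasWidth G w → v ≤ w
width-≤ {φ = φ} {w = w} φ-pres ((xs , antichain , refl) , _) (_ , maximal) =
  subst (_≤ w) (length-map φ xs) (maximal (map φ xs) (map⁺ (AllPairs.map φ-pres antichain)))

module _ (G : Digraph) {h : ℕ} (f : V G → Fin h) where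

  private
    G₀ : Digraph
    G₀ = Quotient G h f

  ≡-or-Reach-trans : ∀ {i j k} → i ≡ j ⊎ Reach G₀ i j → j ≡ k ⊎ Reach G₀ j k →
                     i ≡ k ⊎ Reach G₀ i k
  ≡-or-Reach-trans (inj₁ refl) jk          = jk
  ≡-or-Reach-trans (inj₂ ij)   (inj₁ refl) = inj₂ ij
  ≡-or-Reach-trans (inj₂ ij)   (inj₂ jk)   = inj₂ (ij ++ jk)

  edge-quotient : ∀ {u v} → E G u v → f u ≡ f v ⊎ Reach G₀ (f u) (f v)
  edge-quotient {u} {v} e with f u ≟ f v
  ... | yes fu≡fv = inj₁ fu≡fv
  ... | no  fu≢fv = inj₂ [ fu≢fv , u , v , refl , refl , e ]

  Reach-quotient : ∀ {u v} → Reach G u v → f u ≡ f v ⊎ Reach G₀ (f u) (f v)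
  Reach-quotient [ e ]   = edge-quotient e
  Reach-quotient (e ∷ r) = ≡-or-Reach-trans (edge-quotient e) (Reach-quotient r)

  section-preservesIncomparability : (s : Fin h → V G) → (∀ i → f (s i) ≡ i) →
                                     PreservesIncomparability G₀ G s
  section-preservesIncomparability s fs≡id (i≢j , i↛j , j↛i) =
    (λ si≡sj → i≢j (collapse (cong f si≡sj))) ,
    i↛j ∘ lift i≢j ,
    j↛i ∘ lift (i≢j ∘ sym)
    where
    collapse : ∀ {i j} → f (s i) ≡ f (s j) → i ≡ j
    collapse {i} {j} eq = trans (sym (fs≡id i)) (trans eq (fs≡id j))

    lift : ∀ {i j} → i ≢ j → Reach G (s i) (s j) → Reach G₀ i j
    lift i≢j r with Reach-quotient r
    ... | inj₁ eq = ⊥-elim (i≢j (collapse eq))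
    ... | inj₂ q  = subst₂ (Reach G₀) (fs≡id _) (fs≡id _) q

module _ (G : Digraph) {h : ℕ} (f : V G → Fin h) (i : Fin h) where

  private
    Gᵢ : Digraph
    Gᵢ = Induced G f i

  Reach-induced-or-leaves : ∀ {x y} (fx≡i : f x ≡ i) (fy≡i : f y ≡ i) → Reach G x y →
    Reach Gᵢ (x , fx≡i) (y , fy≡i) ⊎ ∃ λ z → f z ≢ i × Reach G x z × Reach G z y
  Reach-induced-or-leaves fx≡i fy≡i [ e ] = inj₁ [ e ]
  Reach-induced-or-leaves fx≡i fy≡i (_∷_ {y = w} e r) with f w ≟ i
  ... | no fw≢i = inj₂ (w , fw≢i , [ e ] , r)
  ... | yes fw≡i with Reach-induced-or-leaves fw≡i fy≡i r
  ...   | inj₁ q                  = inj₁ (e ∷ q)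
  ...   | inj₂ (z , fz≢i , wz , zy) = inj₂ (z , fz≢i , e ∷ wz , zy)

  Reach-induced : Acyclic G → IsTransitiveModule G (Class G f i) →
    ∀ {x y} (fx≡i : f x ≡ i) (fy≡i : f y ≡ i) → Reach G x y →
    Reach Gᵢ (x , fx≡i) (y , fy≡i)
  Reach-induced acyclic (_ , module-property) {x} {y} fx≡i fy≡i r
    with Reach-induced-or-leaves fx≡i fy≡i r
  ... | inj₁ q = q
  ... | inj₂ (z , fz≢i , xz , zy) =
    ⊥-elim (acyclic x (xz ++ zx))
    where
    zx : Reach G z x
    zx = proj₂ (proj₁ (module-property x y z fx≡i fy≡i fz≢i)) zy

  proj₁-preservesIncomparability : Acyclic G → IsTransitiveModule G (Class G f i) →
                                   PreservesIncomparability Gᵢ G proj₁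
  proj₁-preservesIncomparability acyclic M {x , fx≡i} {y , fy≡i} (x≢y , x↛y , y↛x) =
    (λ { refl → x≢y (cong (x ,_) (Decidable⇒UIP.≡-irrelevant _≟_ fx≡i fy≡i)) }) ,
    x↛y ∘ Reach-induced acyclic M fx≡i fy≡i ,
    y↛x ∘ Reach-induced acyclic M fy≡i fx≡i

Opt-irrelevant : ∀ {b} (x y : Opt b) → x ≡ y
Opt-irrelevant {true} tt tt = refl

module _ (H : Digraph) (bs bt : Bool) where

  private
    H⁺ : Digraph
    H⁺ = Augment H bs bt

  Reach-augment : ∀ {u v} → Reach H u v → Reach H⁺ (inj₂ (inj₁ u)) (inj₂ (inj₁ v))
  Reach-augment [ e ]   = [ e ]
  Reach-augment (e ∷ r) = e ∷ Reach-augment r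

  forget-virtual : V H → V H⁺ → V H
  forget-virtual d (inj₂ (inj₁ u)) = u
  forget-virtual d _               = d

  forget-virtual-preservesIncomparability :
    (d : V H) → PreservesIncomparability H⁺ H (forget-virtual d)
  forget-virtual-preservesIncomparability d {inj₁ s}        {inj₁ s′}       (s≢s′ , _) =
    ⊥-elim (s≢s′ (cong inj₁ (Opt-irrelevant s s′)))
  forget-virtual-preservesIncomparability d {inj₁ _}        {inj₂ (inj₁ _)} (_ , s↛u , _) =
    ⊥-elim (s↛u [ tt ])
  forget-virtual-preservesIncomparability d {inj₁ _}        {inj₂ (inj₂ _)} (_ , s↛t , _) =
    ⊥-elim (s↛t (_∷_ {y = inj₂ (inj₁ d)} tt [ tt ]))
  forget-virtual-preservesIncomparability d {inj₂ (inj₁ _)} {inj₁ _}        (_ , _ , s↛u) =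
    ⊥-elim (s↛u [ tt ])
  forget-virtual-preservesIncomparability d {inj₂ (inj₁ u)} {inj₂ (inj₁ v)} (u≢v , u↛v , v↛u) =
    (λ { refl → u≢v refl }) , u↛v ∘ Reach-augment , v↛u ∘ Reach-augment
  forget-virtual-preservesIncomparability d {inj₂ (inj₁ _)} {inj₂ (inj₂ _)} (_ , u↛t , _) =
    ⊥-elim (u↛t [ tt ])
  forget-virtual-preservesIncomparability d {inj₂ (inj₂ _)} {inj₁ _}        (_ , _ , s↛t) =
    ⊥-elim (s↛t (_∷_ {y = inj₂ (inj₁ d)} tt [ tt ]))
  forget-virtual-preservesIncomparability d {inj₂ (inj₂ _)} {inj₂ (inj₁ _)} (_ , _ , u↛t) =
    ⊥-elim (u↛t [ tt ])
  forget-virtual-preservesIncomparability d {inj₂ (inj₂ t)} {inj₂ (inj₂ t′)} (t≢t′ , _) =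
    ⊥-elim (t≢t′ (cong (inj₂ ∘ inj₂) (Opt-irrelevant t t′)))

lemma13 : (n : ℕ) (E : Fin n → Fin n → Set) →
    IsSTGraph (FinGraph n E) →
    (h : ℕ) (f : Fin n → Fin h) → IsCongruencePartition (FinGraph n E) h f →
    (wG wN : ℕ) → HasWidth (FinGraph n E) wG → HasNeck (FinGraph n E) h f wN →
    wN ≤ wG
lemma13 n E _ h f partition wG wN widthG (_ , _ , inj₁ widthG₀) =
  width-≤ (section-preservesIncomparability G f (proj₁ ∘ representative) (proj₂ ∘ representative))
          widthG₀ widthG
  where
  G : Digraph
  G = FinGraph n E
  representative : ∀ i → Σ (Fin n) (Class G f i)
  representative i = proj₁ (partition i)
lemma13 n E (acyclic , _) h f partition wG wN widthG (_ , _ , inj₂ (i , bs , bt , _ , widthGᵢ)) =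
  width-≤ (proj₁-preservesIncomparability G f i acyclic (partition i)
           ∘ forget-virtual-preservesIncomparability (Induced G f i) bs bt (proj₁ (partition i)))
          widthGᵢ widthG
  where
  G : Digraph
  G = FinGraph n E
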